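{- In each of the categories $\mathbf{KFr}$, $\mathbf{KFr}_f$ and $\mathbf{KFr}_{lf}$, a morphism is an epimorphism if and only if it is surjective as a function.
   Context: A Kripke frame is a pair $(P,R)$ with $R\subseteq P\times P$. A p-morphism $f:(P,R)\to(Q,S)$ is a function with $pRp'\Rightarrow f(p)Sf(p')$ and such that $f(p)Sq'$ implies the existence of $p'$ with $pRp'$ and $f(p')=q'$. $\mathbf{KFr}$ is the category of Kripke frames and p-morphisms; $(P,R)$ is locally finite if $\{q\mid pR^*q\}$ is finite for all $p$ ($R^*$ the reflexive-transitive closure); $\mathbf{KFr}_{lf}$ and $\mathbf{KFr}_f$ are its full subcategories on locally finite, resp. finite, frames. -}

module Defs where

open import Level using (0ℓ)
open import Data.Product using (Σ; _×_; _,_)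
open import Data.List using (List)
open import Data.List.Relation.Unary.Any using (Any)
open import Relation.Binary.Bundles using (Setoid)
open import Relation.Binary.Construct.Closure.ReflexiveTransitive using (Star)
open import Function.Bundles using (_⇔_)

-- A Kripke frame (P , R).  The carrier is a setoid (Agda has no quotient
-- types, so the carrier's equality is carried explicitly); R must respect it.
record Frame : Set₁ where
  field
    setoid : Setoid 0ℓ 0ℓ
  open Setoid setoid public
  field
    R     : Carrier → Carrier → Set
    R-resp : ∀ {x x' y y'} → x ≈ x' → y ≈ y' → R x y → R x' y'

open Frame

record PMor (F G : Frame) : Set where
  field
    fun   : Carrier F → Carrier G
    cong  : ∀ {x y} → _≈_ F x y → _≈_ G (fun x) (fun y)
    forth : ∀ {p p'} → R F p p' → R G (fun p) (fun p')
    back  : ∀ {p q'} → R G (fun p) q' →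
            Σ (Carrier F) (λ p' → R F p p' × _≈_ G (fun p') q')

open PMor public

_≗ₘ_ : ∀ {F G} → PMor F G → PMor F G → Set
_≗ₘ_ {F} {G} g h = ∀ x → _≈_ G (fun g x) (fun h x)

_∘ₘ_ : ∀ {F G H} → PMor G H → PMor F G → Carrier F → Carrier H
g ∘ₘ f = λ x → fun g (fun f x)

Covers : (F : Frame) → List (Carrier F) → (Carrier F → Set) → Set
Covers F L A = ∀ q → A q → Any (_≈_ F q) L

IsFinite : Frame → Set
IsFinite F = Σ (List (Carrier F)) (λ L → Covers F L (λ _ → Data.Unit.⊤))
  where import Data.Unit

IsLocallyFinite : Frame → Set
IsLocallyFinite F =
  ∀ p → Σ (List (Carrier F)) (λ L → Covers F L (λ q → Star (R F) p q))

-- any frame (the whole category KFr)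
AnyFrame : Frame → Set
AnyFrame _ = Data.Unit.⊤
  where import Data.Unit

-- f is an epimorphism in the full subcategory of KFr on frames satisfying C
IsEpiIn : (Frame → Set) → ∀ {F G} → PMor F G → Set₁
IsEpiIn C {F} {G} f =
  (Z : Frame) → C Z → (g h : PMor G Z) →
  (∀ x → _≈_ Z ((g ∘ₘ f) x) ((h ∘ₘ f) x)) → g ≗ₘ h

IsSurjective : ∀ {F G} → PMor F G → Set
IsSurjective {F} {G} f = ∀ q → Σ (Carrier F) (λ p → _≈_ G (fun f p) q)

EpiIffSurjIn : (Frame → Set) → Set₁
EpiIffSurjIn C = ∀ (F G : Frame) → C F → C G → (f : PMor F G) →
  (IsEpiIn C f → IsSurjective f) × (IsSurjective f → IsEpiIn C f)

-- Surjective maps are epic in any category of structured sets.  Conversely,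
-- glue two copies of the target G along the image of f.  The image of a
-- p-morphism is closed under successors (back condition), so the relation of
-- G lifts consistently to the glued frame, and the two inclusions of G are
-- p-morphisms that agree on the image of f but differ at every point outside
-- it.  Gluing at most doubles each (R*-cone of a) frame, so it stays inside
-- the finite and the locally finite subcategories.
module Submission where

open import Defs
open import Data.Bool using (Bool; true; false)
open import Data.List using (List; map; _++_)
open import Data.List.Relation.Unary.Any as Any using (Any)
open import Data.List.Relation.Unary.Any.Properties using (map⁺; ++⁺ˡ; ++⁺ʳ)
open import Data.Product using (Σ; _×_; _,_; proj₁; proj₂)
open import Data.Sum using (_⊎_; inj₁; inj₂)
open import Data.Unit using (tt)
open import Relation.Binary.PropositionalEquality as ≡ using (_≡_)
open import Relation.Binary.Construct.Closure.ReflexiveTransitive using (Star; gmap)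
open Frame

surjective⇒epi : ∀ C {F G} (f : PMor F G) → IsSurjective f → IsEpiIn C f
surjective⇒epi C f surj Z _ g h gf≈hf q =
  let p , fp≈q = surj q
  in Frame.trans Z (Frame.sym Z (cong g fp≈q)) (Frame.trans Z (gf≈hf p) (cong h fp≈q))

module Gluing {F G : Frame} (f : PMor F G) where
  private module G = Frame G

  InImage : Carrier G → Set
  InImage q = Σ (Carrier F) (λ p → fun f p G.≈ q)

  InImage-resp : ∀ {x y} → x G.≈ y → InImage x → InImage y
  InImage-resp x≈y (p , fp≈x) = p , G.trans fp≈x x≈y

  InImage-upward : ∀ {x y} → InImage x → G.R x y → InImage y
  InImage-upward (p , fp≈x) xRy =
    let p' , _ , fp'≈y = back f (G.R-resp (G.sym fp≈x) G.refl xRy)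
    in p' , fp'≈y

  _≈ᵍ_ : Bool × Carrier G → Bool × Carrier G → Set
  (b , x) ≈ᵍ (c , y) = x G.≈ y × (b ≡ c ⊎ InImage x)

  ≈ᵍ-refl : ∀ {z} → z ≈ᵍ z
  ≈ᵍ-refl = G.refl , inj₁ ≡.refl

  ≈ᵍ-sym : ∀ {z w} → z ≈ᵍ w → w ≈ᵍ z
  ≈ᵍ-sym (x≈y , inj₁ b≡c) = G.sym x≈y , inj₁ (≡.sym b≡c)
  ≈ᵍ-sym (x≈y , inj₂ im)  = G.sym x≈y , inj₂ (InImage-resp x≈y im)

  ≈ᵍ-trans : ∀ {z w v} → z ≈ᵍ w → w ≈ᵍ v → z ≈ᵍ v
  ≈ᵍ-trans (x≈y , inj₂ im)  (y≈z , _)          = G.trans x≈y y≈z , inj₂ im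
  ≈ᵍ-trans (x≈y , inj₁ b≡c) (y≈z , inj₁ c≡d)   = G.trans x≈y y≈z , inj₁ (≡.trans b≡c c≡d)
  ≈ᵍ-trans (x≈y , inj₁ _)   (y≈z , inj₂ im)    =
    G.trans x≈y y≈z , inj₂ (InImage-resp (G.sym x≈y) im)

  Rᵍ : Bool × Carrier G → Bool × Carrier G → Set
  Rᵍ (b , x) (c , y) = G.R x y × (b ≡ c ⊎ InImage y)

  Rᵍ-resp : ∀ {z z' w w'} → z ≈ᵍ z' → w ≈ᵍ w' → Rᵍ z w → Rᵍ z' w'
  Rᵍ-resp (x≈x' , _) (y≈y' , _) (xRy , inj₂ im) =
    G.R-resp x≈x' y≈y' xRy , inj₂ (InImage-resp y≈y' im)
  Rᵍ-resp (x≈x' , inj₂ im) (y≈y' , _) (xRy , inj₁ _) =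
    G.R-resp x≈x' y≈y' xRy , inj₂ (InImage-resp y≈y' (InImage-upward im xRy))
  Rᵍ-resp (x≈x' , inj₁ _) (y≈y' , inj₂ im) (xRy , inj₁ _) =
    G.R-resp x≈x' y≈y' xRy , inj₂ (InImage-resp y≈y' im)
  Rᵍ-resp (x≈x' , inj₁ b≡b') (y≈y' , inj₁ c≡c') (xRy , inj₁ b≡c) =
    G.R-resp x≈x' y≈y' xRy , inj₁ (≡.trans (≡.sym b≡b') (≡.trans b≡c c≡c'))

  Glued : Frame
  Glued = record
    { setoid = record
      { Carrier       = Bool × Carrier G
      ; _≈_           = _≈ᵍ_
      ; isEquivalence = record { refl = ≈ᵍ-refl ; sym = ≈ᵍ-sym ; trans = ≈ᵍ-trans } }
    ; R      = Rᵍ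
    ; R-resp = Rᵍ-resp }

  inclusion : Bool → PMor G Glued
  inclusion b = record
    { fun   = b ,_
    ; cong  = λ x≈y → x≈y , inj₁ ≡.refl
    ; forth = λ xRy → xRy , inj₁ ≡.refl
    ; back  = λ { {q' = _ , y} (xRy , side) → y , xRy , G.refl , side } }

  inclusions-agree-on-image : ∀ p →
    _≈_ Glued (fun (inclusion true) (fun f p)) (fun (inclusion false) (fun f p))
  inclusions-agree-on-image p = G.refl , inj₂ (p , G.refl)

  inclusions-agree⇒InImage : ∀ {q} →
    _≈_ Glued (fun (inclusion true) q) (fun (inclusion false) q) → InImage q
  inclusions-agree⇒InImage (_ , inj₂ im) = im

  both-copies : List (Carrier G) → List (Bool × Carrier G)
  both-copies L = map (true ,_) L ++ map (false ,_) L

  both-copies-covers : ∀ {L A} → Covers G L A →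
    Covers Glued (both-copies L) (λ z → A (proj₂ z))
  both-copies-covers cov (true , q) a =
    ++⁺ˡ (map⁺ (Any.map (λ q≈x → q≈x , inj₁ ≡.refl) (cov q a)))
  both-copies-covers {L} cov (false , q) a =
    ++⁺ʳ (map (true ,_) L) (map⁺ (Any.map (λ q≈x → q≈x , inj₁ ≡.refl) (cov q a)))

  Glued-isFinite : IsFinite G → IsFinite Glued
  Glued-isFinite (L , cov) = both-copies L , both-copies-covers cov

  Glued-isLocallyFinite : IsLocallyFinite G → IsLocallyFinite Glued
  Glued-isLocallyFinite lf (_ , p) =
    let L , cov = lf p
    in both-copies L , λ z z* → both-copies-covers cov z (gmap proj₂ proj₁ z*)

open Gluing using (Glued; inclusion; inclusions-agree-on-image; inclusions-agree⇒InImage)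

epi⇒surjective : ∀ C {F G} (f : PMor F G) → C (Glued f) → IsEpiIn C f → IsSurjective f
epi⇒surjective C f glued∈C epi q =
  inclusions-agree⇒InImage f
    (epi (Glued f) glued∈C (inclusion f true) (inclusion f false) (inclusions-agree-on-image f) q)

epi⇔surjective : ∀ C → (∀ {F G} (f : PMor F G) → C G → C (Glued f)) → EpiIffSurjIn C
epi⇔surjective C closed F G _ G∈C f =
  epi⇒surjective C f (closed f G∈C) , surjective⇒epi C f

mainTheorem11 : EpiIffSurjIn AnyFrame × EpiIffSurjIn IsFinite × EpiIffSurjIn IsLocallyFinite
mainTheorem11 =
  epi⇔surjective AnyFrame (λ _ _ → tt) ,
  epi⇔surjective IsFinite (λ f → Gluing.Glued-isFinite f) ,
  epi⇔surjective IsLocallyFinite (λ f → Gluing.Glued-isLocallyFinite f)
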